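{- Every graph containing neither $2K_2$ nor $C_4$ as an induced subgraph has cochromatic number at most $3$.
   Context: The cochromatic number of $G$ is the minimum number of sets in a partition of $V(G)$ into sets each of which induces a clique or an independent set. -}

module Defs where

open import Data.Nat using (ℕ)
open import Data.Fin using (Fin)
open import Data.Product using (Σ; _×_; ∃-syntax)
open import Data.Sum using (_⊎_)
open import Relation.Nullary using (¬_; Dec)
open import Relation.Binary.PropositionalEquality using (_≡_; _≢_)
open import Level using (0ℓ)

record Graph (n : ℕ) : Set₁ where
  field
    Adj     : Fin n → Fin n → Set
    adj?    : ∀ u v → Dec (Adj u v)
    irrefl  : ∀ v → ¬ Adj v v
    sym     : ∀ {u v} → Adj u v → Adj v u

module _ {n : ℕ} (G : Graph n) where
  open Graph G

  Distinct4 : Fin n → Fin n → Fin n → Fin n → Set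
  Distinct4 a b c d =
    a ≢ b × a ≢ c × a ≢ d × b ≢ c × b ≢ d × c ≢ d

  Induced2K2 : Fin n → Fin n → Fin n → Fin n → Set
  Induced2K2 a b c d =
    Distinct4 a b c d × Adj a b × Adj c d ×
    ¬ Adj a c × ¬ Adj a d × ¬ Adj b c × ¬ Adj b d

  InducedC4 : Fin n → Fin n → Fin n → Fin n → Set
  InducedC4 a b c d =
    Distinct4 a b c d × Adj a b × Adj b c × Adj c d × Adj d a ×
    ¬ Adj a c × ¬ Adj b d

  Has2K2 : Set
  Has2K2 = ∃[ a ] ∃[ b ] ∃[ c ] ∃[ d ] Induced2K2 a b c d

  HasC4 : Set
  HasC4 = ∃[ a ] ∃[ b ] ∃[ c ] ∃[ d ] InducedC4 a b c d

  IsClique : (Fin n → Set) → Set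
  IsClique S = ∀ u v → S u → S v → u ≢ v → Adj u v

  IsIndependent : (Fin n → Set) → Set
  IsIndependent S = ∀ u v → S u → S v → ¬ Adj u v

  -- V(G) can be partitioned into at most k sets, each a clique or an
  -- independent set (classes of c : Fin n → Fin k; empty classes allowed,
  -- which is harmless for "at most k").
  CochromaticAtMost : ℕ → Set
  CochromaticAtMost k =
    Σ (Fin n → Fin k) λ col →
      ∀ (i : Fin k) →
        IsClique (λ v → col v ≡ i) ⊎ IsIndependent (λ v → col v ≡ i)

module Submission where

-- Grow a clique K greedily by two moves: add a vertex adjacent to all
-- of K, or, if two adjacent outside vertices x, y both miss exactly the same
-- vertex f i of K, replace f i by x and add y.  Since a clique has at most n
-- vertices, after finitely many moves we reach a "stuck" clique.  For a stuck
-- clique every outside vertex misses at least one vertex of K, and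
--   * (no C₄) adjacent outside vertices x, y never have "crossing" misses:
--     it cannot be that x misses a vertex y sees while y misses one x sees;
--   * (no 2K₂) adjacent outside vertices never miss two common vertices.
-- Hence the outside vertices missing exactly one vertex of K form an
-- independent set (equal misses are excluded by stuckness, different ones
-- cross), and so do those missing at least two; together with K itself
-- this gives three classes.

open import Defs
open import Data.Nat using (ℕ; zero; suc; _+_)
open import Data.Nat.Properties using (+-suc; +-identityʳ; n<1+n)
open import Data.Fin using (Fin; zero; suc; _≟_)
open import Data.Fin.Properties using (any?; all?; ¬∀⟶∃¬; pigeonhole; <⇒≢)
open import Data.Vec.Functional using (_∷_; updateAt)
open import Data.Vec.Functional.Properties using (updateAt-updates; updateAt-minimal)
open import Data.Product using (Σ; _×_; _,_; ∃-syntax)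
open import Data.Sum using (_⊎_; inj₁; inj₂)
open import Data.Empty using (⊥; ⊥-elim)
open import Function using (const)
open import Relation.Unary using (Decidable)
open import Relation.Nullary using (¬_; Dec; yes; no)
open import Relation.Nullary.Decidable using (_×-dec_; _→-dec_; ¬?)
open import Relation.Binary.PropositionalEquality
  using (_≡_; _≢_; refl; sym; trans; cong; subst; subst₂)

module Cochromatic {n : ℕ} (G : Graph n) where
  open Graph G renaming (sym to adj-sym)

  adj⇒≢ : ∀ {u v} → Adj u v → u ≢ v
  adj⇒≢ {u} uv refl = irrefl u uv

  IsCliqueMap : ∀ {k} → (Fin k → Fin n) → Set
  IsCliqueMap f = ∀ i j → i ≢ j → Adj (f i) (f j)

  Clique : ℕ → Set
  Clique k = Σ (Fin k → Fin n) IsCliqueMap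

  noCliqueAbove : ¬ Clique (suc n)
  noCliqueAbove (f , cl) with pigeonhole (n<1+n n) f
  ... | i , j , i<j , fi≡fj = adj⇒≢ (cl i j (<⇒≢ i<j)) fi≡fj

  cons-clique : ∀ {m} s (g : Fin m → Fin n) → IsCliqueMap g →
                (∀ i → Adj s (g i)) → IsCliqueMap (s ∷ g)
  cons-clique s g clg sg zero    zero    0≢0 = ⊥-elim (0≢0 refl)
  cons-clique s g clg sg zero    (suc j) _   = sg j
  cons-clique s g clg sg (suc i) zero    _   = adj-sym (sg i)
  cons-clique s g clg sg (suc i) (suc j) i≢j = clg i j (λ i≡j → i≢j (cong suc i≡j))

  -- Greedy growth terminates: if every clique either grows by one vertex or
  -- yields R, then R holds (start from the empty clique; d bounds the moves).
  growUntil : {R : Set} → (∀ {k} → Clique k → Clique (suc k) ⊎ R) → R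
  growUntil {R} grow = go (suc n) (+-identityʳ (suc n)) ((λ ()) , λ ())
    where
    go : ∀ d {k} → d + k ≡ suc n → Clique k → R
    go zero    k≡1+n K = ⊥-elim (noCliqueAbove (subst Clique k≡1+n K))
    go (suc d) {k} e K with grow K
    ... | inj₁ K′ = go d (trans (+-suc d k) e) K′
    ... | inj₂ r  = r

  splitCochromatic : {P Q : Fin n → Set} → Decidable P → Decidable Q →
    IsClique G P → IsIndependent G (λ v → ¬ P v × Q v) →
    IsIndependent G (λ v → ¬ P v × ¬ Q v) → CochromaticAtMost G 3
  splitCochromatic {P} {Q} P? Q? clP indQ indR = colour , classes
    where
    class : ∀ {v} → Dec (P v) → Dec (Q v) → Fin 3
    class (yes _) _      = zero
    class (no _)  (yes _) = suc zero
    class (no _)  (no _)  = suc (suc zero)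

    colour : Fin n → Fin 3
    colour v = class (P? v) (Q? v)

    in₀ : ∀ {v} (p : Dec (P v)) (q : Dec (Q v)) → class p q ≡ zero → P v
    in₀ (yes pv) _ _ = pv
    in₀ (no _) (yes _) ()
    in₀ (no _) (no _)  ()

    in₁ : ∀ {v} (p : Dec (P v)) (q : Dec (Q v)) → class p q ≡ suc zero →
          ¬ P v × Q v
    in₁ (yes _) _ ()
    in₁ (no ¬pv) (yes qv) _ = ¬pv , qv
    in₁ (no _) (no _) ()

    in₂ : ∀ {v} (p : Dec (P v)) (q : Dec (Q v)) → class p q ≡ suc (suc zero) →
          ¬ P v × ¬ Q v
    in₂ (yes _) _ ()
    in₂ (no _) (yes _) ()
    in₂ (no ¬pv) (no ¬qv) _ = ¬pv , ¬qv

    classes : ∀ c → IsClique G (λ v → colour v ≡ c) ⊎ IsIndependent G (λ v → colour v ≡ c)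
    classes zero = inj₁ λ u v cu cv →
      clP u v (in₀ (P? u) (Q? u) cu) (in₀ (P? v) (Q? v) cv)
    classes (suc zero) = inj₂ λ u v cu cv →
      indQ u v (in₁ (P? u) (Q? u) cu) (in₁ (P? v) (Q? v) cv)
    classes (suc (suc zero)) = inj₂ λ u v cu cv →
      indR u v (in₂ (P? u) (Q? u) cu) (in₂ (P? v) (Q? v) cv)

  module AroundClique {k : ℕ} (f : Fin k → Fin n) (cl : IsCliqueMap f) where

    Inside Outside : Fin n → Set
    Inside s  = ∃[ i ] f i ≡ s
    Outside s = ¬ Inside s

    inside? : Decidable Inside
    inside? s = any? (λ i → f i ≟ s)

    outside⇒≢ : ∀ {s} → Outside s → ∀ i → s ≢ f i
    outside⇒≢ out i s≡fi = out (i , sym s≡fi)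

    MissesOnly : Fin n → Fin k → Set
    MissesOnly s i = ¬ Adj s (f i) × (∀ j → j ≢ i → Adj s (f j))

    missesOnly? : ∀ s i → Dec (MissesOnly s i)
    missesOnly? s i =
      ¬? (adj? s (f i)) ×-dec all? (λ j → ¬? (j ≟ i) →-dec adj? s (f j))

    MissesOne MissesTwo : Fin n → Set
    MissesOne s = ∃[ i ] MissesOnly s i
    MissesTwo s = ∃[ p ] ∃[ q ] p ≢ q × ¬ Adj s (f p) × ¬ Adj s (f q)

    missesOne? : Decidable MissesOne
    missesOne? s = any? (missesOnly? s)

    Extendable Swappable : Set
    Extendable = ∃[ s ] ∀ i → Adj s (f i)
    Swappable  = ∃[ x ] ∃[ y ] Adj x y × ∃[ i ] MissesOnly x i × MissesOnly y i

    extendable? : Dec Extendable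
    extendable? = any? (λ s → all? (λ i → adj? s (f i)))

    swappable? : Dec Swappable
    swappable? = any? λ x → any? λ y →
      adj? x y ×-dec any? (λ i → missesOnly? x i ×-dec missesOnly? y i)

    extend : Extendable → Clique (suc k)
    extend (s , sK) = s ∷ f , cons-clique s f cl sK

    module Replace (x : Fin n) (i : Fin k) where
      g : Fin k → Fin n
      g = updateAt f i (const x)

      entry : ∀ j → (j ≡ i × g j ≡ x) ⊎ (j ≢ i × g j ≡ f j)
      entry j with j ≟ i
      ... | yes refl = inj₁ (refl , updateAt-updates i f)
      ... | no j≢i   = inj₂ (j≢i , updateAt-minimal j i f j≢i)

      replace-clique : (∀ j → j ≢ i → Adj x (f j)) → IsCliqueMap g
      replace-clique xK a b a≢b with entry a | entry b
      ... | inj₁ (refl , _)  | inj₁ (refl , _)  = ⊥-elim (a≢b refl)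
      ... | inj₁ (refl , ga) | inj₂ (b≢i , gb) = subst₂ Adj (sym ga) (sym gb) (xK b b≢i)
      ... | inj₂ (a≢i , ga) | inj₁ (refl , gb) =
        subst₂ Adj (sym ga) (sym gb) (adj-sym (xK a a≢i))
      ... | inj₂ (_ , ga)   | inj₂ (_ , gb)    = subst₂ Adj (sym ga) (sym gb) (cl a b a≢b)

      sees-replaced : ∀ {y} → Adj y x → (∀ j → j ≢ i → Adj y (f j)) → ∀ j → Adj y (g j)
      sees-replaced {y} yx yK j with entry j
      ... | inj₁ (_ , gj)   = subst (Adj y) (sym gj) yx
      ... | inj₂ (j≢i , gj) = subst (Adj y) (sym gj) (yK j j≢i)

    swap-extend : Swappable → Clique (suc k)
    swap-extend (x , y , xy , i , (_ , xK) , (_ , yK)) =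
      y ∷ g , cons-clique y g (replace-clique xK) (sees-replaced (adj-sym xy) yK)
      where open Replace x i

    missesTwo : ¬ Extendable → ∀ {s} → Outside s → ¬ MissesOne s → MissesTwo s
    missesTwo ¬ext {s} out ¬one with ¬∀⟶∃¬ k (λ i → Adj s (f i)) (λ i → adj? s (f i))
                                             (λ sK → ¬ext (s , sK))
    ... | i , si with ¬∀⟶∃¬ k (λ j → j ≢ i → Adj s (f j))
                              (λ j → ¬? (j ≟ i) →-dec adj? s (f j)) (λ sK → ¬one (i , si , sK))
    ... | j , sj = j , i , (λ j≡i → sj (λ j≢i → ⊥-elim (j≢i j≡i))) , (λ a → sj (λ _ → a)) , si

    module Forbidden (no2K2 : ¬ Has2K2 G) (noC4 : ¬ HasC4 G) where

      -- (no C₄) adjacent outside x, y have no crossing misses: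
      -- otherwise x – f i – f j – y – x is an induced C₄
      noCrossing : ∀ {x y} → Outside x → Outside y → Adj x y → ∀ i j →
        Adj x (f i) → ¬ Adj y (f i) → Adj y (f j) → ¬ Adj x (f j) → ⊥
      noCrossing {x} {y} outx outy xy i j xi yi yj xj =
        noC4 (x , f i , f j , y ,
              (adj⇒≢ xi , outside⇒≢ outx j , adj⇒≢ xy , adj⇒≢ fifj ,
               (λ fi≡y → outside⇒≢ outy i (sym fi≡y)) , (λ fj≡y → adj⇒≢ yj (sym fj≡y))) ,
              xi , fifj , adj-sym yj , adj-sym xy , xj , (λ fiy → yi (adj-sym fiy)))
        where
        fifj : Adj (f i) (f j)
        fifj = cl i j (λ { refl → xj xi })

      noCommonPair : ∀ {x y} → Outside x → Outside y → Adj x y → ∀ i j → i ≢ j →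
        ¬ Adj x (f i) → ¬ Adj x (f j) → ¬ Adj y (f i) → ¬ Adj y (f j) → ⊥
      noCommonPair {x} {y} outx outy xy i j i≢j xi xj yi yj =
        no2K2 (x , y , f i , f j ,
               (adj⇒≢ xy , outside⇒≢ outx i , outside⇒≢ outx j ,
                outside⇒≢ outy i , outside⇒≢ outy j , adj⇒≢ (cl i j i≢j)) ,
               xy , cl i j i≢j , xi , xj , yi , yj)

      inherit : ∀ {x y} → Outside x → Outside y → Adj x y → ∀ i →
        ¬ Adj x (f i) → Adj y (f i) → ∀ j → ¬ Adj y (f j) → ¬ Adj x (f j)
      inherit outx outy xy i xi yi j yj xj =
        noCrossing outy outx (adj-sym xy) i j yi xi xj yj

      -- vertices missing two clique vertices are pairwise non-adjacent:
      -- y must miss both misses of x, which then are two common misses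
      missesTwo-independent : ∀ {x y} → Outside x → Outside y →
        MissesTwo x → MissesTwo y → ¬ Adj x y
      missesTwo-independent {x} {y} outx outy (p , q , p≢q , xp , xq) (p′ , q′ , p′≢q′ , yp′ , yq′) xy =
        noCommonPair outx outy xy p q p≢q xp xq (yMisses p xp) (yMisses q xq)
        where
        yMisses : ∀ i → ¬ Adj x (f i) → ¬ Adj y (f i)
        yMisses i xi yi = noCommonPair outx outy xy p′ q′ p′≢q′
          (inherit outx outy xy i xi yi p′ yp′) (inherit outx outy xy i xi yi q′ yq′) yp′ yq′

      -- vertices missing exactly one clique vertex are pairwise non-adjacent
      -- unless the second move applies: different misses would cross
      missesOne-independent : ¬ Swappable → ∀ {x y} → Outside x → Outside y →
        MissesOne x → MissesOne y → ¬ Adj x y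
      missesOne-independent ¬swap {x} {y} outx outy (i , x-only) (i′ , y-only) xy
        with i ≟ i′ | x-only | y-only
      ... | yes refl | _ | _ = ¬swap (x , y , xy , i , x-only , y-only)
      ... | no i≢i′ | (xi , xK) | (yi′ , yK) =
        noCrossing outx outy xy i′ i (xK i′ (λ i′≡i → i≢i′ (sym i′≡i))) yi′ (yK i i≢i′) xi

      stuck-cochromatic : ¬ Extendable → ¬ Swappable → CochromaticAtMost G 3
      stuck-cochromatic ¬ext ¬swap =
        splitCochromatic inside? missesOne? insideClique
          (λ u v (outu , oneu) (outv , onev) →
             missesOne-independent ¬swap outu outv oneu onev)
          (λ u v (outu , ¬oneu) (outv , ¬onev) →
             missesTwo-independent outu outv (missesTwo ¬ext outu ¬oneu)
                                             (missesTwo ¬ext outv ¬onev))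
        where
        insideClique : IsClique G Inside
        insideClique _ _ (i , refl) (j , refl) fi≢fj = cl i j (λ i≡j → fi≢fj (cong f i≡j))

      growOrColour : Clique (suc k) ⊎ CochromaticAtMost G 3
      growOrColour with extendable? | swappable?
      ... | yes ext | _        = inj₁ (extend ext)
      ... | no _    | yes swap = inj₁ (swap-extend swap)
      ... | no ¬ext | no ¬swap = inj₂ (stuck-cochromatic ¬ext ¬swap)

lemma15 : (n : ℕ) (G : Graph n) → ¬ Has2K2 G → ¬ HasC4 G →
    CochromaticAtMost G 3
lemma15 n G no2K2 noC4 =
  growUntil (λ (f , cl) → AroundClique.Forbidden.growOrColour f cl no2K2 noC4)
  where open Cochromatic G
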